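{- Let $\mathbf{L}\in\{\mathbf{K},\mathbf{T},\mathbf{K4},\mathbf{S4}\}$. Then (1) $\mathbf{L}^{Horn,\Box}$ is strongly less expressive than $\mathbf{L}^{Horn}$, and (2) $\mathbf{L}^{Core,\Box}$ is strongly less expressive than $\mathbf{L}^{Core}$.
   Context: Fix a countable set $\mathcal P$ of propositional letters; Kripke models $M=(W,R,V)$ with $V:W\to2^{\mathcal P}$ and standard modal satisfaction. $\mathbf{K},\mathbf{T},\mathbf{K4},\mathbf{S4}$ are interpreted over all, reflexive, transitive, and reflexive-transitive frames respectively. Positive literals: $\lambda ::= \top \mid p \mid \Diamond\lambda \mid \Box\lambda$. A clause is $\Box^s(\neg\lambda_1\vee\dots\vee\neg\lambda_n\vee\lambda_{n+1}\vee\dots\vee\lambda_{n+m})$ ($s,n,m\ge0$, $\Box^s$ = $s$ nested boxes); clausal-form formulas are finite conjunctions of clauses (literals count as clauses). $\mathbf{L}^{Horn}$: all clauses have $m\le1$; $\mathbf{L}^{Core}$: all clauses have $m\le 1$ and $n+m\le2$. $\mathbf{L}^{Horn,\Box}$, $\mathbf{L}^{Core,\Box}$: the same, with the additional requirement that all positive literals are built without $\Diamond$. All are interpreted over the frame class of $\mathbf{L}$. For languages $\mathcal L_1,\mathcal L_2$ over the same frame class $\mathcal C$, a model-extending translation from $\mathcal L_1$ to $\mathcal L_2$ is an effective map sending each $\mathcal L_1$-formula $\varphi$ over alphabet $\mathcal P_0$ to an $\mathcal L_2$-formula $\varphi'$ over $\mathcal P'\supseteq\mathcal P_0$ such that for every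 model $M$ over a frame in $\mathcal C$ and world $w$, $M,w\models\varphi$ iff the valuation of $M$ can be extended to $\mathcal P'$ giving $M'$ with $M',w\models\varphi'$. $\mathcal L_1$ is strongly less expressive than $\mathcal L_2$ if there is a model-extending translation from $\mathcal L_1$ to $\mathcal L_2$ but none from $\mathcal L_2$ to $\mathcal L_1$. -}

module Defs where

open import Data.Nat using (ℕ; zero; suc; _+_; _≤_)
open import Data.Bool using (Bool; true)
open import Data.List using (List; []; _∷_; _++_; length; concatMap)
open import Data.List.Relation.Unary.All using (All)
open import Data.List.Relation.Unary.Any using (Any)
open import Data.List.Membership.Propositional using (_∈_)
open import Data.Product using (Σ; _×_)
open import Data.Unit using (⊤)
open import Data.Empty using (⊥)
open import Relation.Binary.PropositionalEquality using (_≡_)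
open import Relation.Nullary using (¬_)
open import Function.Bundles using (_⇔_)
open import Level using (0ℓ)

data Logic : Set where
  K T K4 S4 : Logic

Reflexive : {W : Set} → (W → W → Set) → Set
Reflexive {W} R = (w : W) → R w w

Transitive : {W : Set} → (W → W → Set) → Set
Transitive {W} R = (u v w : W) → R u v → R v w → R u w

FrameOf : Logic → {W : Set} → (W → W → Set) → Set
FrameOf K  R = ⊤
FrameOf T  R = Reflexive R
FrameOf K4 R = Transitive R
FrameOf S4 R = Reflexive R × Transitive R

-- propositional letters are natural numbers (a countable set P);
-- a valuation assigns to each world a subset of P
Val : Set → Set
Val W = W → ℕ → Bool

data PosLit : Set where
  top : PosLit
  var : ℕ → PosLit
  dia : PosLit → PosLit
  box : PosLit → PosLit

-- □^s (¬λ₁ ∨ … ∨ ¬λₙ ∨ λₙ₊₁ ∨ … ∨ λₙ₊ₘ)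
record Clause : Set where
  constructor clause
  field
    boxes : ℕ
    neg   : List PosLit
    pos   : List PosLit
open Clause public

CForm : Set
CForm = List Clause

Reach : {W : Set} → (W → W → Set) → ℕ → W → W → Set
Reach R zero    w v = w ≡ v
Reach R (suc n) w v = Σ _ λ u → R w u × Reach R n u v

satL : {W : Set} → (W → W → Set) → Val W → W → PosLit → Set
satL R V w top     = ⊤
satL R V w (var p) = V w p ≡ true
satL R V w (dia l) = Σ _ λ v → R w v × satL R V v l
satL R V w (box l) = ∀ v → R w v → satL R V v l

-- ¬λ₁ ∨ … ∨ ¬λₙ ∨ λₙ₊₁ ∨ … ∨ λₙ₊ₘ, written in the classically
-- equivalent form (λ₁ ∧ … ∧ λₙ) → (λₙ₊₁ ∨ … ∨ λₙ₊ₘ)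
satC : {W : Set} → (W → W → Set) → Val W → W → Clause → Set
satC R V w c =
  ∀ v → Reach R (boxes c) w v →
    All (satL R V v) (neg c) → Any (satL R V v) (pos c)

sat : {W : Set} → (W → W → Set) → Val W → W → CForm → Set
sat R V w φ = All (satC R V w) φ

varsL : PosLit → List ℕ
varsL top     = []
varsL (var p) = p ∷ []
varsL (dia l) = varsL l
varsL (box l) = varsL l

varsC : Clause → List ℕ
varsC c = concatMap varsL (neg c) ++ concatMap varsL (pos c)

vars : CForm → List ℕ
vars φ = concatMap varsC φ

Agree : {W : Set} → CForm → Val W → Val W → Set
Agree {W} φ V V' = ∀ p → p ∈ vars φ → (w : W) → V' w p ≡ V w p

Language : Set₁
Language = CForm → Set

diaFree : PosLit → Set
diaFree top     = ⊤
diaFree (var p) = ⊤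
diaFree (dia l) = ⊥
diaFree (box l) = diaFree l

HornClause : Clause → Set
HornClause c = length (pos c) ≤ 1

CoreClause : Clause → Set
CoreClause c = length (pos c) ≤ 1 × length (neg c) + length (pos c) ≤ 2

BoxClause : Clause → Set
BoxClause c = All diaFree (neg c) × All diaFree (pos c)

Horn : Language
Horn φ = All HornClause φ

Core : Language
Core φ = All CoreClause φ

HornBox : Language
HornBox φ = All (λ c → HornClause c × BoxClause c) φ

CoreBox : Language
CoreBox φ = All (λ c → CoreClause c × BoxClause c) φ

ModelExtendingTranslation : Logic → Language → Language → Set₁
ModelExtendingTranslation L L₁ L₂ =
  Σ (CForm → CForm) λ τ →
    (φ : CForm) → L₁ φ →
      L₂ (τ φ) ×
      ((W : Set) (R : W → W → Set) → FrameOf L R →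
        (V : Val W) (w : W) →
        (sat R V w φ ⇔ Σ (Val W) λ V' → Agree φ V V' × sat R V' w (τ φ)))

StronglyLessExpressive : Logic → Language → Language → Set₁
StronglyLessExpressive L L₁ L₂ =
  ModelExtendingTranslation L L₁ L₂ × ¬ ModelExtendingTranslation L L₂ L₁

-- A clause built from □-literals with at most one positive literal is
-- preserved by intersecting valuations pointwise, hence so is the
-- existence of a valuation extension satisfying a translation into a
-- □-Horn (or □-Core) language.  The formula ◇p does not have this
-- property: on the complete two-world frame, p true only at one world
-- and p true only at the other both satisfy ◇p, but their intersection
-- does not.  The converse translations are the identity, since
-- satisfaction depends only on the letters of a formula.
module Submission where

open import Defs
open import Data.Bool using (Bool; true; false; _∧_; not)
open import Data.Nat using (ℕ; _≤_; s≤s; z≤n)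
open import Data.List using (List; []; _∷_; _++_; concatMap; length)
open import Data.List.Membership.Propositional using (_∈_)
open import Data.List.Membership.Propositional.Properties using (∈-++⁺ˡ; ∈-++⁺ʳ)
open import Data.List.Relation.Unary.All as All using (All; []; _∷_)
open import Data.List.Relation.Unary.Any using (Any; here; there)
open import Data.Product using (Σ; _×_; _,_; proj₁; proj₂)
open import Data.Unit using (⊤; tt)
open import Data.Empty using (⊥)
open import Relation.Binary.PropositionalEquality using (_≡_; refl; sym; trans; cong₂)
open import Relation.Nullary using (¬_)
open import Function.Bundles using (_⇔_; mk⇔; Equivalence)

∧-≡-true⁺ : ∀ {a b} → a ≡ true → b ≡ true → a ∧ b ≡ true
∧-≡-true⁺ refl refl = refl

∧-≡-true⁻ : ∀ a {b} → a ∧ b ≡ true → a ≡ true × b ≡ true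
∧-≡-true⁻ true e = refl , e

module _ {W : Set} where

  AgreeOn : List ℕ → Val W → Val W → Set
  AgreeOn xs V V' = ∀ p → p ∈ xs → (w : W) → V w p ≡ V' w p

  agreeOn-sym : ∀ {xs V V'} → AgreeOn xs V V' → AgreeOn xs V' V
  agreeOn-sym ag p p∈ w = sym (ag p p∈ w)

  agreeOn-++ˡ : ∀ xs {ys V V'} → AgreeOn (xs ++ ys) V V' → AgreeOn xs V V'
  agreeOn-++ˡ xs ag p p∈ = ag p (∈-++⁺ˡ p∈)

  agreeOn-++ʳ : ∀ xs {ys V V'} → AgreeOn (xs ++ ys) V V' → AgreeOn ys V V'
  agreeOn-++ʳ xs ag p p∈ = ag p (∈-++⁺ʳ xs p∈)

  module _ (R : W → W → Set) where

    satL-resp : ∀ l {V V'} → AgreeOn (varsL l) V V' → ∀ w → satL R V w l → satL R V' w l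
    satL-resp top     ag w s             = s
    satL-resp (var p) ag w s             = trans (sym (ag p (here refl) w)) s
    satL-resp (dia l) ag w (v , wRv , s) = v , wRv , satL-resp l ag v s
    satL-resp (box l) ag w s v wRv       = satL-resp l ag v (s v wRv)

    all-satL-resp : ∀ ls {V V'} → AgreeOn (concatMap varsL ls) V V' →
                    ∀ w → All (satL R V w) ls → All (satL R V' w) ls
    all-satL-resp []       ag w []       = []
    all-satL-resp (l ∷ ls) ag w (s ∷ ss) =
      satL-resp l (agreeOn-++ˡ (varsL l) ag) w s ∷ all-satL-resp ls (agreeOn-++ʳ (varsL l) ag) w ss

    any-satL-resp : ∀ ls {V V'} → AgreeOn (concatMap varsL ls) V V' →
                    ∀ w → Any (satL R V w) ls → Any (satL R V' w) ls
    any-satL-resp (l ∷ ls) ag w (here s)  = here (satL-resp l (agreeOn-++ˡ (varsL l) ag) w s)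
    any-satL-resp (l ∷ ls) ag w (there s) = there (any-satL-resp ls (agreeOn-++ʳ (varsL l) ag) w s)

    satC-resp : ∀ c {V V'} → AgreeOn (varsC c) V V' → ∀ w → satC R V w c → satC R V' w c
    satC-resp c ag w s v reach negs =
      any-satL-resp (pos c) (agreeOn-++ʳ (concatMap varsL (neg c)) ag) v
        (s v reach (all-satL-resp (neg c) (agreeOn-sym (agreeOn-++ˡ (concatMap varsL (neg c)) ag)) v negs))

    sat-resp : ∀ φ {V V'} → AgreeOn (vars φ) V V' → ∀ w → sat R V w φ → sat R V' w φ
    sat-resp []      ag w []       = []
    sat-resp (c ∷ φ) ag w (s ∷ ss) =
      satC-resp c (agreeOn-++ˡ (varsC c) ag) w s ∷ sat-resp φ (agreeOn-++ʳ (varsC c) ag) w ss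

inclusion-translation : ∀ L {L₁ L₂ : Language} → (∀ φ → L₁ φ → L₂ φ) →
                        ModelExtendingTranslation L L₁ L₂
inclusion-translation L L₁⊆L₂ = (λ φ → φ) , λ φ φ∈L₁ → L₁⊆L₂ φ φ∈L₁ , λ W R _ V w →
  mk⇔ (λ s → V , (λ _ _ _ → refl) , s)
      (λ { (V' , ag , s) → sat-resp R φ ag w s })

translation-weaken : ∀ L {L₁ L₂ L₃ : Language} → (∀ φ → L₂ φ → L₃ φ) →
                     ModelExtendingTranslation L L₁ L₂ → ModelExtendingTranslation L L₁ L₃
translation-weaken L L₂⊆L₃ (τ , τ-ok) =
  τ , λ φ φ∈L₁ → L₂⊆L₃ (τ φ) (proj₁ (τ-ok φ φ∈L₁)) , proj₂ (τ-ok φ φ∈L₁)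

_∩ᵛ_ : {W : Set} → Val W → Val W → Val W
(V₁ ∩ᵛ V₂) w p = V₁ w p ∧ V₂ w p

agree-∩ᵛ : ∀ {W} φ {V₁ V₁' V₂ V₂' : Val W} →
           Agree φ V₁ V₁' → Agree φ V₂ V₂' → Agree φ (V₁ ∩ᵛ V₂) (V₁' ∩ᵛ V₂')
agree-∩ᵛ φ ag₁ ag₂ p p∈ w = cong₂ _∧_ (ag₁ p p∈ w) (ag₂ p p∈ w)

module _ {W : Set} (R : W → W → Set) (V₁ V₂ : Val W) where

  satL-∩ᵛ : ∀ l → diaFree l → ∀ w → satL R (V₁ ∩ᵛ V₂) w l ⇔ (satL R V₁ w l × satL R V₂ w l)
  satL-∩ᵛ top     _ w = mk⇔ (λ _ → tt , tt) (λ _ → tt)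
  satL-∩ᵛ (var p) _ w = mk⇔ (∧-≡-true⁻ (V₁ w p)) (λ (s₁ , s₂) → ∧-≡-true⁺ s₁ s₂)
  satL-∩ᵛ (box l) d w = mk⇔
    (λ s → (λ v wRv → proj₁ (Equivalence.to (satL-∩ᵛ l d v) (s v wRv)))
         , (λ v wRv → proj₂ (Equivalence.to (satL-∩ᵛ l d v) (s v wRv))))
    (λ (s₁ , s₂) v wRv → Equivalence.from (satL-∩ᵛ l d v) (s₁ v wRv , s₂ v wRv))

  -- the single positive literal is where the Horn condition is used
  any-satL-∩ᵛ : ∀ ls → All diaFree ls → length ls ≤ 1 → ∀ w →
                Any (satL R V₁ w) ls → Any (satL R V₂ w) ls → Any (satL R (V₁ ∩ᵛ V₂) w) ls
  any-satL-∩ᵛ (l ∷ []) (d ∷ _) _ w (here s₁) (here s₂) = here (Equivalence.from (satL-∩ᵛ l d w) (s₁ , s₂))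
  any-satL-∩ᵛ (_ ∷ _ ∷ _) _ (s≤s ()) _ _ _

  sat-∩ᵛ : ∀ φ → HornBox φ → ∀ w → sat R V₁ w φ → sat R V₂ w φ → sat R (V₁ ∩ᵛ V₂) w φ
  sat-∩ᵛ []      []                       w []         []         = []
  sat-∩ᵛ (c ∷ φ) ((horn , dn , dp) ∷ hs) w (s₁ ∷ ss₁) (s₂ ∷ ss₂) =
    (λ v reach negs →
      let negs₁₂ = All.unzip (All.zipWith (λ (d , s) → Equivalence.to (satL-∩ᵛ _ d v) s) (dn , negs))
      in any-satL-∩ᵛ (pos c) dp horn v (s₁ v reach (proj₁ negs₁₂)) (s₂ v reach (proj₂ negs₁₂)))
    ∷ sat-∩ᵛ φ hs w ss₁ ss₂

◇p : CForm
◇p = clause 0 [] (dia (var 0) ∷ []) ∷ []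

◇p-horn : Horn ◇p
◇p-horn = s≤s z≤n ∷ []

◇p-core : Core ◇p
◇p-core = (s≤s z≤n , s≤s z≤n) ∷ []

Complete : Bool → Bool → Set
Complete _ _ = ⊤

complete-frame : ∀ L → FrameOf L Complete
complete-frame K  = tt
complete-frame T  = λ _ → tt
complete-frame K4 = λ _ _ _ _ _ → tt
complete-frame S4 = (λ _ → tt) , (λ _ _ _ _ _ → tt)

only-true only-false : Val Bool
only-true  w _ = w
only-false w _ = not w

◇p-of-witness : ∀ V w₀ → V w₀ 0 ≡ true → sat Complete V true ◇p
◇p-of-witness V w₀ Vw₀ = (λ _ _ _ → here (w₀ , tt , Vw₀)) ∷ []

¬◇p-only-true∩only-false : ¬ sat Complete (only-true ∩ᵛ only-false) true ◇p
¬◇p-only-true∩only-false (s ∷ []) with s true refl []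
... | here (true  , _ , ())
... | here (false , _ , ())

¬translation-into-HornBox : ∀ L {L₁ : Language} → L₁ ◇p → ¬ ModelExtendingTranslation L L₁ HornBox
¬translation-into-HornBox L ◇p∈L₁ (τ , τ-ok) =
  refute (Equivalence.to (τ-correct only-true)  (◇p-of-witness only-true  true  refl))
         (Equivalence.to (τ-correct only-false) (◇p-of-witness only-false false refl))
  where
  τ-correct : ∀ V → sat Complete V true ◇p ⇔ Σ (Val Bool) λ V' → Agree ◇p V V' × sat Complete V' true (τ ◇p)
  τ-correct V = proj₂ (τ-ok ◇p ◇p∈L₁) Bool Complete (complete-frame L) V true

  refute : Σ (Val Bool) (λ V' → Agree ◇p only-true V' × sat Complete V' true (τ ◇p)) →
           Σ (Val Bool) (λ V' → Agree ◇p only-false V' × sat Complete V' true (τ ◇p)) → ⊥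
  refute (V₁ , ag₁ , s₁) (V₂ , ag₂ , s₂) =
    ¬◇p-only-true∩only-false (Equivalence.from (τ-correct (only-true ∩ᵛ only-false))
      (V₁ ∩ᵛ V₂ , agree-∩ᵛ ◇p ag₁ ag₂ , sat-∩ᵛ Complete V₁ V₂ (τ ◇p) (proj₁ (τ-ok ◇p ◇p∈L₁)) true s₁ s₂))

HornBox⊆Horn : ∀ φ → HornBox φ → Horn φ
HornBox⊆Horn _ = All.map proj₁

CoreBox⊆Core : ∀ φ → CoreBox φ → Core φ
CoreBox⊆Core _ = All.map proj₁

CoreBox⊆HornBox : ∀ φ → CoreBox φ → HornBox φ
CoreBox⊆HornBox _ = All.map λ ((horn , _) , □-only) → horn , □-only

theorem3p6 : (L : Logic) →
    StronglyLessExpressive L HornBox Horn × StronglyLessExpressive L CoreBox Core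
theorem3p6 L =
  ( (inclusion-translation L HornBox⊆Horn , ¬translation-into-HornBox L ◇p-horn)
  , (inclusion-translation L CoreBox⊆Core
    , λ τ → ¬translation-into-HornBox L ◇p-core (translation-weaken L CoreBox⊆HornBox τ)) )
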